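{- Let $G$ be a simple connected graph of order $n\geq 3$, and let $V=V(G)\subseteq V(R(G))$. If $S\subseteq V$ is a differential set of $R(G)$, then the subgraph $\langle B_G(S)\rangle$ of $G$ induced by $B_G(S)$ has maximum degree at most $2$. Moreover, if $S$ is a maximal differential set of $R(G)$, then $\langle B_G(S)\rangle$ has maximum degree at most $1$.
   Context: $R(G)$ is the graph obtained from $G$ by adding, for each edge $e=xy\in E(G)$, a new vertex $v_e$ adjacent exactly to $x$ and $y$. For a graph $H$ and $S\subseteq V(H)$, $B_H(S)$ is the set of vertices of $H$ not in $S$ that are adjacent in $H$ to some vertex of $S$, $\partial_H(S)=|B_H(S)|-|S|$, $\partial(H)=\max_{S\subseteq V(H)}\partial_H(S)$, and $S$ is a differential set of $H$ if $\partial_H(S)=\partial(H)$. A maximal differential set is one not properly contained in another differential set. -}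

module Defs where

open import Data.Nat using (ℕ; _≤_; _+_)
open import Data.Bool using (Bool; true; false; _∧_; _∨_; not; if_then_else_; T)
open import Data.Fin using (Fin; toℕ; splitAt)
open import Data.Fin.Subset using (Subset; ∣_∣; _∈_; _⊆_)
open import Data.Vec using (Vec; tabulate; lookup; _++_; replicate)
open import Data.List using (List; []; _∷_; concatMap; length; allFin)
import Data.List as L
open import Data.Product using (_×_; _,_)
open import Data.Sum using (inj₁; inj₂)
open import Data.Integer using (ℤ; +_; _-_) renaming (_≤_ to _≤ℤ_)
open import Relation.Nullary.Decidable using (⌊_⌋)
open import Relation.Binary.PropositionalEquality using (_≡_)
import Data.Fin as F
import Data.Nat as N

record Graph (n : ℕ) : Set where
  field
    adj    : Fin n → Fin n → Bool
    sym    : ∀ i j → adj i j ≡ adj j i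
    irrefl : ∀ i → adj i i ≡ false
open Graph public

data Reachable {n : ℕ} (G : Graph n) : Fin n → Fin n → Set where
  here : ∀ {u} → Reachable G u u
  step : ∀ {u v w} → T (adj G u v) → Reachable G v w → Reachable G u w

Connected : {n : ℕ} → Graph n → Set
Connected G = ∀ u v → Reachable G u v

anyFin : {m : ℕ} → (Fin m → Bool) → Bool
anyFin {m} p = L.foldr (λ x b → p x ∨ b) false (allFin m)

Bd : {m : ℕ} → (Fin m → Fin m → Bool) → Subset m → Subset m
Bd a S = tabulate λ v → not (lookup S v) ∧ anyFin (λ u → lookup S u ∧ a u v)

∂ : {m : ℕ} → (Fin m → Fin m → Bool) → Subset m → ℤ
∂ a S = + ∣ Bd a S ∣ - + ∣ S ∣

IsDifferential : {m : ℕ} → (Fin m → Fin m → Bool) → Subset m → Set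
IsDifferential a S = ∀ T → ∂ a T ≤ℤ ∂ a S

IsMaximalDifferential : {m : ℕ} → (Fin m → Fin m → Bool) → Subset m → Set
IsMaximalDifferential a S =
  IsDifferential a S × (∀ T → IsDifferential a T → S ⊆ T → T ≡ S)

edges : {n : ℕ} → Graph n → List (Fin n × Fin n)
edges {n} G = concatMap (λ i → concatMap (λ j →
  if (toℕ i N.<ᵇ toℕ j) ∧ adj G i j then (i , j) ∷ [] else []) (allFin n)) (allFin n)

-- Number of vertices of R(G): n original vertices followed by one per edge.
order-R : {n : ℕ} → Graph n → ℕ
order-R {n} G = n + length (edges G)

incident : {n : ℕ} → Fin n → Fin n × Fin n → Bool
incident a (i , j) = ⌊ a F.≟ i ⌋ ∨ ⌊ a F.≟ j ⌋

-- Adjacency of R(G): G's edges, plus v_e adjacent exactly to the ends of e.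
adjR : {n : ℕ} → (G : Graph n) → Fin (order-R G) → Fin (order-R G) → Bool
adjR {n} G x y with splitAt n x | splitAt n y
... | inj₁ a | inj₁ b = adj G a b
... | inj₁ a | inj₂ e = incident a (L.lookup (edges G) e)
... | inj₂ e | inj₁ b = incident b (L.lookup (edges G) e)
... | inj₂ _ | inj₂ _ = false

embed : {n : ℕ} → (G : Graph n) → Subset n → Subset (order-R G)
embed G S = S ++ replicate _ false

MaxDegInducedAtMost : {n : ℕ} → Graph n → Subset n → ℕ → Set
MaxDegInducedAtMost G X k =
  ∀ v → v ∈ X → ∣ tabulate (λ u → lookup X u ∧ adj G u v) ∣ ≤ k

-- Let v ∈ B_G(S) have d neighbours in B_G(S), and put S⁺ = S ∪ {v}.  Passing from S to S⁺
-- in R(G) removes at most v from the boundary and adds the d subdivision vertices v_{vw} of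
-- the edges from v to its neighbours w in B_G(S); these were not boundary vertices before,
-- since neither v nor w lies in S.  As |S⁺| = |S| + 1, this gives ∂(S⁺) ≥ ∂(S) + d − 2.
-- So d ≤ 2 when S is differential, and when d ≥ 2 the set S⁺ is differential as well and
-- strictly contains S, which maximality of S forbids.
module Submission where

import Data.Nat.Properties

open import Algebra.Properties.CommutativeMonoid.Sum Data.Nat.Properties.+-0-commutativeMonoid
  using (sum; sum-remove; sum-cong-≗; ∑-distrib-+)
open import Data.Bool using (Bool; true; false; _∧_; _∨_; not; T; if_then_else_)
open import Data.Bool.ListAction using (any)
open import Data.Bool.Properties
  using (T-≡; T-∧; T-∨; T-not-≡; ¬-not; ∧-zeroʳ; ∧-identityʳ; ∨-zeroʳ; ∨-comm; ∧-comm)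
open import Data.Fin using (Fin; zero; suc; toℕ; punchIn; _↑ˡ_; _↑ʳ_; _≟_)
open import Data.Fin.Properties using (toℕ-injective; splitAt-↑ˡ; splitAt-↑ʳ)
open import Data.Fin.Subset
  using (Subset; ∣_∣; _∪_; _∩_; ⊥; ⁅_⁆; inside; outside; Empty; _∈_; _∉_; _⊆_)
open import Data.Fin.Subset.Properties
  using (Empty-unique; ∣⊥∣≡0; ∉⊥; p⊆q⇒∣p∣≤∣q∣; _∈?_; x∈p∪q⁺; x∈p∪q⁻; x∈p∩q⁻; x∈⁅x⁆;
         x∈⁅y⁆⇒x≡y; p⊆p∪q; ∣⁅x⁆∣≡1)
import Data.Integer as ℤ
open ℤ using () renaming (_≤_ to _≤ℤ_)
import Data.Integer.Properties as ℤₚ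
open import Data.Integer.Tactic.RingSolver using (solve-∀)
open import Data.List as List using (List; []; _∷_; concatMap)
open import Data.List.Membership.Propositional using (lose)
open import Data.List.Membership.Propositional.Properties using (∈-allFin)
open import Data.List.Properties using (map-++; foldr-map)
open import Data.List.Relation.Unary.Any using (satisfied)
open import Data.List.Relation.Unary.Any.Properties using (any⁺; any⁻)
open import Data.Nat using (ℕ; zero; suc; _+_; _≤_; _<_; _<ᵇ_; z≤n)
open import Data.Nat.ListAction using () renaming (sum to sumᴸ)
open import Data.Nat.ListAction.Properties using (sum-++)
open import Data.Nat.Properties hiding (_≟_)
open import Data.Nat.Tactic.RingSolver using () renaming (solve-∀ to ℕ-solve-∀)
open import Data.Product using (_×_; _,_; ∃; ∃-syntax; proj₁)
open import Data.Sum using (_⊎_; inj₁; inj₂)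
import Data.Sum as ⊎
open import Data.Vec using ([]; _∷_; _++_; tabulate; lookup)
open import Data.Vec.Functional using (removeAt)
open import Data.Vec.Properties
  using (lookup∘tabulate; []=⇒lookup; lookup⇒[]=; lookup-++ˡ; lookup-++ʳ)
open import Function using (_∘_; _⇔_; mk⇔; Equivalence)
open Equivalence using (to; from)
open import Relation.Binary.Definitions using (tri<; tri≈; tri>)
open import Relation.Binary.PropositionalEquality
open import Relation.Nullary using (yes; no; contradiction)
open import Relation.Nullary.Decidable using (⌊_⌋; toWitness; fromWitness)

open import Defs hiding (sym)
open Graph using () renaming (sym to adj-sym)

𝟙 : Bool → ℕ
𝟙 true  = 1
𝟙 false = 0

sum-mono-≤ : ∀ {n} {f g : Fin n → ℕ} → (∀ i → f i ≤ g i) → sum f ≤ sum g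
sum-mono-≤ {zero}  _   = z≤n
sum-mono-≤ {suc n} f≤g = +-mono-≤ (f≤g zero) (sum-mono-≤ (f≤g ∘ suc))

term≤sum : ∀ {n} (f : Fin n → ℕ) i → f i ≤ sum f
term≤sum {suc n} f i = ≤-trans (m≤m+n (f i) _) (≤-reflexive (sym (sum-remove f)))

sum-row+sum-column≤sum : ∀ {n} (X : Fin n → Fin n → ℕ) v → X v v ≡ 0 →
                         sum (X v) + sum (λ i → X i v) ≤ sum (λ i → sum (X i))
sum-row+sum-column≤sum {suc n} X v Xvv≡0 = begin
  sum (X v) + sum column                     ≡⟨ cong (sum (X v) +_) (sum-remove column) ⟩
  sum (X v) + (X v v + sum (removeAt column v))
    ≡⟨ cong (λ x → sum (X v) + (x + sum (removeAt column v))) Xvv≡0 ⟩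
  sum (X v) + sum (removeAt column v)
    ≤⟨ +-monoʳ-≤ (sum (X v)) (sum-mono-≤ λ j → term≤sum (X (punchIn v j)) v) ⟩
  sum (X v) + sum (removeAt rows v)          ≡⟨ sum-remove rows ⟨
  sum rows                                   ∎
  where
  open ≤-Reasoning
  column rows : Fin (suc n) → ℕ
  column i = X i v
  rows   i = sum (X i)

∣p++q∣≡∣p∣+∣q∣ : ∀ {m n} (p : Subset m) (q : Subset n) → ∣ p ++ q ∣ ≡ ∣ p ∣ + ∣ q ∣
∣p++q∣≡∣p∣+∣q∣ []            q = refl
∣p++q∣≡∣p∣+∣q∣ (inside  ∷ p) q = cong suc (∣p++q∣≡∣p∣+∣q∣ p q)
∣p++q∣≡∣p∣+∣q∣ (outside ∷ p) q = ∣p++q∣≡∣p∣+∣q∣ p q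

∣p∣+∣q∣≡∣p∪q∣+∣p∩q∣ : ∀ {n} (p q : Subset n) → ∣ p ∣ + ∣ q ∣ ≡ ∣ p ∪ q ∣ + ∣ p ∩ q ∣
∣p∣+∣q∣≡∣p∪q∣+∣p∩q∣ []            []            = refl
∣p∣+∣q∣≡∣p∪q∣+∣p∩q∣ (inside  ∷ p) (inside  ∷ q) =
  cong suc (trans (+-suc _ _) (trans (cong suc (∣p∣+∣q∣≡∣p∪q∣+∣p∩q∣ p q)) (sym (+-suc _ _))))
∣p∣+∣q∣≡∣p∪q∣+∣p∩q∣ (inside  ∷ p) (outside ∷ q) = cong suc (∣p∣+∣q∣≡∣p∪q∣+∣p∩q∣ p q)
∣p∣+∣q∣≡∣p∪q∣+∣p∩q∣ (outside ∷ p) (inside  ∷ q) =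
  trans (+-suc _ _) (cong suc (∣p∣+∣q∣≡∣p∪q∣+∣p∩q∣ p q))
∣p∣+∣q∣≡∣p∪q∣+∣p∩q∣ (outside ∷ p) (outside ∷ q) = ∣p∣+∣q∣≡∣p∪q∣+∣p∩q∣ p q

∣p∪q∣≤∣p∣+∣q∣ : ∀ {n} (p q : Subset n) → ∣ p ∪ q ∣ ≤ ∣ p ∣ + ∣ q ∣
∣p∪q∣≤∣p∣+∣q∣ p q = ≤-trans (m≤m+n _ _) (≤-reflexive (sym (∣p∣+∣q∣≡∣p∪q∣+∣p∩q∣ p q)))

disjoint⇒∣p∪q∣≡∣p∣+∣q∣ : ∀ {n} (p q : Subset n) → Empty (p ∩ q) → ∣ p ∪ q ∣ ≡ ∣ p ∣ + ∣ q ∣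
disjoint⇒∣p∪q∣≡∣p∣+∣q∣ {n} p q p∩q≡∅ = begin
  ∣ p ∪ q ∣              ≡⟨ +-identityʳ _ ⟨
  ∣ p ∪ q ∣ + 0          ≡⟨ cong (∣ p ∪ q ∣ +_) (trans (cong ∣_∣ (Empty-unique p∩q≡∅)) (∣⊥∣≡0 n)) ⟨
  ∣ p ∪ q ∣ + ∣ p ∩ q ∣  ≡⟨ ∣p∣+∣q∣≡∣p∪q∣+∣p∩q∣ p q ⟨
  ∣ p ∣ + ∣ q ∣          ∎
  where open ≡-Reasoning

∣tabulate∣≡sum𝟙 : ∀ {n} (f : Fin n → Bool) → ∣ tabulate f ∣ ≡ sum (𝟙 ∘ f)
∣tabulate∣≡sum𝟙 {zero}  f = refl
∣tabulate∣≡sum𝟙 {suc n} f with f zero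
... | true  = cong suc (∣tabulate∣≡sum𝟙 (f ∘ suc))
... | false = ∣tabulate∣≡sum𝟙 (f ∘ suc)

sum-lookup : ∀ {A : Set} (h : A → ℕ) (xs : List A) →
             sum (h ∘ List.lookup xs) ≡ sumᴸ (List.map h xs)
sum-lookup h []       = refl
sum-lookup h (x ∷ xs) = cong (h x +_) (sum-lookup h xs)

sumᴸ-map-tabulate : ∀ {A : Set} {n} (h : A → ℕ) (f : Fin n → A) →
                    sumᴸ (List.map h (List.tabulate f)) ≡ sum (h ∘ f)
sumᴸ-map-tabulate {n = zero}  h f = refl
sumᴸ-map-tabulate {n = suc n} h f = cong (h (f zero) +_) (sumᴸ-map-tabulate h (f ∘ suc))

sumᴸ-map-concatMap : ∀ {A B : Set} (h : B → ℕ) (f : A → List B) (xs : List A) →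
                     sumᴸ (List.map h (concatMap f xs)) ≡ sumᴸ (List.map (sumᴸ ∘ List.map h ∘ f) xs)
sumᴸ-map-concatMap h f []       = refl
sumᴸ-map-concatMap h f (x ∷ xs) = begin
  sumᴸ (List.map h (f x List.++ concatMap f xs))               ≡⟨ cong sumᴸ (map-++ h (f x) _) ⟩
  sumᴸ (List.map h (f x) List.++ List.map h (concatMap f xs))  ≡⟨ sum-++ (List.map h (f x)) _ ⟩
  sumᴸ (List.map h (f x)) + sumᴸ (List.map h (concatMap f xs))
    ≡⟨ cong (sumᴸ (List.map h (f x)) +_) (sumᴸ-map-concatMap h f xs) ⟩
  sumᴸ (List.map h (f x)) + sumᴸ (List.map (sumᴸ ∘ List.map h ∘ f) xs) ∎
  where open ≡-Reasoning

sum-edges : ∀ {n} (G : Graph n) (h : Fin n × Fin n → ℕ) →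
            sum (h ∘ List.lookup (edges G)) ≡
            sum λ i → sum λ j → if (toℕ i <ᵇ toℕ j) ∧ adj G i j then h (i , j) else 0
sum-edges {n} G h = begin
  sum (h ∘ List.lookup (edges G))
    ≡⟨ sum-lookup h (edges G) ⟩
  sumᴸ (List.map h (edges G))
    ≡⟨ sumᴸ-map-concatMap h row (List.allFin n) ⟩
  sumᴸ (List.map (sumᴸ ∘ List.map h ∘ row) (List.allFin n))
    ≡⟨ sumᴸ-map-tabulate (sumᴸ ∘ List.map h ∘ row) (λ i → i) ⟩
  sum (sumᴸ ∘ List.map h ∘ row)
    ≡⟨ sum-cong-≗ (λ i → trans (sumᴸ-map-concatMap h (entry i) (List.allFin n))
                               (sumᴸ-map-tabulate (sumᴸ ∘ List.map h ∘ entry i) (λ j → j))) ⟩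
  sum (λ i → sum λ j → sumᴸ (List.map h (entry i j)))
    ≡⟨ sum-cong-≗ (λ i → sum-cong-≗ (sumᴸ-entry i)) ⟩
  sum (λ i → sum λ j → if (toℕ i <ᵇ toℕ j) ∧ adj G i j then h (i , j) else 0) ∎
  where
  open ≡-Reasoning
  entry : Fin n → Fin n → List (Fin n × Fin n)
  entry i j = if (toℕ i <ᵇ toℕ j) ∧ adj G i j then (i , j) ∷ [] else []
  row : Fin n → List (Fin n × Fin n)
  row i = concatMap (entry i) (List.allFin n)
  sumᴸ-entry : ∀ i j → sumᴸ (List.map h (entry i j)) ≡
                       (if (toℕ i <ᵇ toℕ j) ∧ adj G i j then h (i , j) else 0)
  sumᴸ-entry i j with (toℕ i <ᵇ toℕ j) ∧ adj G i j
  ... | true  = +-identityʳ (h (i , j))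
  ... | false = refl

if-≤ : ∀ b {x y} → (b ≡ true → x ≤ y) → (if b then x else 0) ≤ y
if-≤ true  x≤y = x≤y refl
if-≤ false _   = z≤n

-- Each edge uv is listed once in edges G, oriented by toℕ, so it is counted either in row v
-- or in column v of the matrix X below.
star≤sum-edges : ∀ {n} (G : Graph n) (v : Fin n) (h : Fin n × Fin n → ℕ) →
                 (∀ i j → h (i , j) ≡ h (j , i)) →
                 sum (λ u → if adj G u v then h (u , v) else 0) ≤ sum (h ∘ List.lookup (edges G))
star≤sum-edges {n} G v h h-sym = begin
  sum (λ u → if adj G u v then h (u , v) else 0)  ≤⟨ sum-mono-≤ star≤row+column ⟩
  sum (λ u → X v u + X u v)                       ≡⟨ ∑-distrib-+ (X v) (λ u → X u v) ⟩
  sum (X v) + sum (λ u → X u v)                   ≤⟨ sum-row+sum-column≤sum X v Xvv≡0 ⟩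
  sum (λ i → sum (X i))                           ≡⟨ sum-edges G h ⟨
  sum (h ∘ List.lookup (edges G))                 ∎
  where
  open ≤-Reasoning
  X : Fin n → Fin n → ℕ
  X i j = if (toℕ i <ᵇ toℕ j) ∧ adj G i j then h (i , j) else 0

  Xvv≡0 : X v v ≡ 0
  Xvv≡0 rewrite irrefl G v | ∧-zeroʳ (toℕ v <ᵇ toℕ v) = refl

  X-edge : ∀ i j → toℕ i < toℕ j → adj G i j ≡ true → X i j ≡ h (i , j)
  X-edge i j i<j ij rewrite to T-≡ (<⇒<ᵇ i<j) | ij = refl

  star≤row+column : ∀ u → (if adj G u v then h (u , v) else 0) ≤ X v u + X u v
  star≤row+column u = if-≤ (adj G u v) λ uv → by-order uv (<-cmp (toℕ u) (toℕ v))
    where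
    by-order : adj G u v ≡ true → _ → h (u , v) ≤ X v u + X u v
    by-order uv (tri< u<v _ _) = ≤-trans (≤-reflexive (sym (X-edge u v u<v uv))) (m≤n+m _ _)
    by-order uv (tri≈ _ u≡v _) with refl ← toℕ-injective u≡v =
      contradiction (trans (sym uv) (irrefl G u)) λ ()
    by-order uv (tri> _ _ v<u) = ≤-trans (≤-reflexive h[u,v]≡X[v,u]) (m≤m+n _ _)
      where h[u,v]≡X[v,u] = trans (h-sym u v) (sym (X-edge v u v<u (trans (adj-sym G v u) uv)))

∈⇔T-lookup : ∀ {m} {x : Fin m} {p : Subset m} → x ∈ p ⇔ T (lookup p x)
∈⇔T-lookup {x = x} {p} = mk⇔ (from T-≡ ∘ []=⇒lookup) (lookup⇒[]= x p ∘ to T-≡)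

∉⇔T-not-lookup : ∀ {m} {x : Fin m} {p : Subset m} → x ∉ p ⇔ T (not (lookup p x))
∉⇔T-not-lookup {x = x} {p} = mk⇔
  (λ x∉p → from T-not-≡ (¬-not (x∉p ∘ lookup⇒[]= x p)))
  (λ t x∈p → subst (T ∘ not) ([]=⇒lookup x∈p) t)

anyFin≡any : ∀ {m} (p : Fin m → Bool) → anyFin p ≡ any p (List.allFin m)
anyFin≡any {m} p = sym (foldr-map _∨_ p false (List.allFin m))

anyFin⁺ : ∀ {m} (p : Fin m → Bool) {i} → T (p i) → T (anyFin p)
anyFin⁺ {m} p {i} pi =
  subst T (sym (anyFin≡any p)) (any⁺ p (lose {xs = List.allFin m} (∈-allFin i) pi))

anyFin⁻ : ∀ {m} (p : Fin m → Bool) → T (anyFin p) → ∃ (T ∘ p)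
anyFin⁻ {m} p = satisfied ∘ any⁻ p (List.allFin m) ∘ subst T (anyFin≡any p)

module _ {m} (a : Fin m → Fin m → Bool) where

  ∈-Bd⇔ : ∀ {X y} → y ∈ Bd a X ⇔ (y ∉ X × ∃[ x ] (x ∈ X × T (a x y)))
  ∈-Bd⇔ {X} {y} = mk⇔ unpack pack
    where
    lookup-Bd : lookup (Bd a X) y ≡ not (lookup X y) ∧ anyFin (λ x → lookup X x ∧ a x y)
    lookup-Bd = lookup∘tabulate _ y

    unpack : y ∈ Bd a X → y ∉ X × ∃[ x ] (x ∈ X × T (a x y))
    unpack y∈Bd with y∉X , neighbour ← to T-∧ (subst T lookup-Bd (to ∈⇔T-lookup y∈Bd))
                with x , X[x]∧axy ← anyFin⁻ _ neighbour
                with x∈X , axy ← to T-∧ X[x]∧axy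
      = from ∉⇔T-not-lookup y∉X , x , from ∈⇔T-lookup x∈X , axy

    pack : y ∉ X × ∃[ x ] (x ∈ X × T (a x y)) → y ∈ Bd a X
    pack (y∉X , x , x∈X , axy) = from ∈⇔T-lookup (subst T (sym lookup-Bd)
      (from T-∧ (to ∉⇔T-not-lookup y∉X ,
                 anyFin⁺ (λ x → lookup X x ∧ a x y) (from T-∧ (to ∈⇔T-lookup x∈X , axy)))))

  Bd-mono : ∀ {X Y y} → X ⊆ Y → y ∉ Y → y ∈ Bd a X → y ∈ Bd a Y
  Bd-mono X⊆Y y∉Y y∈BdX with _ , x , x∈X , axy ← to ∈-Bd⇔ y∈BdX =
    from ∈-Bd⇔ (y∉Y , x , X⊆Y x∈X , axy)

data ↑-View (m : ℕ) {n : ℕ} : Fin (m + n) → Set where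
  at-↑ˡ : (i : Fin m) → ↑-View m (i ↑ˡ n)
  at-↑ʳ : (j : Fin n) → ↑-View m (m ↑ʳ j)

↑-view : ∀ m {n} (i : Fin (m + n)) → ↑-View m i
↑-view zero    i       = at-↑ʳ i
↑-view (suc m) zero    = at-↑ˡ zero
↑-view (suc m) (suc i) with ↑-view m i
... | at-↑ˡ j = at-↑ˡ (suc j)
... | at-↑ʳ j = at-↑ʳ j

module _ {m n} (p : Subset m) (q : Subset n) where

  ↑ˡ∈++⇔ : ∀ {i} → i ↑ˡ n ∈ p ++ q ⇔ i ∈ p
  ↑ˡ∈++⇔ {i} = mk⇔ (from ∈⇔T-lookup ∘ subst T (lookup-++ˡ p q i) ∘ to ∈⇔T-lookup)
                   (from ∈⇔T-lookup ∘ subst T (sym (lookup-++ˡ p q i)) ∘ to ∈⇔T-lookup)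

  ↑ʳ∈++⇔ : ∀ {j} → m ↑ʳ j ∈ p ++ q ⇔ j ∈ q
  ↑ʳ∈++⇔ {j} = mk⇔ (from ∈⇔T-lookup ∘ subst T (lookup-++ʳ p q j) ∘ to ∈⇔T-lookup)
                   (from ∈⇔T-lookup ∘ subst T (sym (lookup-++ʳ p q j)) ∘ to ∈⇔T-lookup)

incident⇔ : ∀ {n} {a i j : Fin n} → T (incident a (i , j)) ⇔ (a ≡ i ⊎ a ≡ j)
incident⇔ {a = a} {i} {j} = mk⇔
  (⊎.map (toWitness {a? = a ≟ i}) (toWitness {a? = a ≟ j}) ∘ to T-∨)
  (from T-∨ ∘ ⊎.map (fromWitness {a? = a ≟ i}) (fromWitness {a? = a ≟ j}))

module _ {n} (G : Graph n) where

  private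
    k : ℕ
    k = List.length (edges G)

  adjR-↑ˡ-↑ʳ : ∀ a e → adjR G (a ↑ˡ k) (n ↑ʳ e) ≡ incident a (List.lookup (edges G) e)
  adjR-↑ˡ-↑ʳ a e rewrite splitAt-↑ˡ n a k | splitAt-↑ʳ n k e = refl

  ↑ʳ∉embed : ∀ {X e} → n ↑ʳ e ∉ embed G X
  ↑ʳ∉embed {X} = ∉⊥ ∘ to (↑ʳ∈++⇔ X ⊥)

  embed-mono : ∀ {X Y} → X ⊆ Y → embed G X ⊆ embed G Y
  embed-mono {X} {Y} X⊆Y {y} y∈X with ↑-view n y
  ... | at-↑ˡ u = from (↑ˡ∈++⇔ Y ⊥) (X⊆Y (to (↑ˡ∈++⇔ X ⊥) y∈X))
  ... | at-↑ʳ e = contradiction y∈X ↑ʳ∉embed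

  ∣embed∣ : ∀ X → ∣ embed G X ∣ ≡ ∣ X ∣
  ∣embed∣ X = trans (∣p++q∣≡∣p∣+∣q∣ X ⊥) (trans (cong (∣ X ∣ +_) (∣⊥∣≡0 k)) (+-identityʳ _))

module Extension {n} (G : Graph n) (S : Subset n) {v : Fin n} (v∈B : v ∈ Bd (adj G) S) where

  private
    k : ℕ
    k = List.length (edges G)

  B S⁺ : Subset n
  B  = Bd (adj G) S
  S⁺ = S ∪ ⁅ v ⁆

  E E⁺ : Subset (order-R G)
  E  = embed G S
  E⁺ = embed G S⁺

  v̂ : Fin (order-R G)
  v̂ = v ↑ˡ k

  ∈B⇒∉S : ∀ {u} → u ∈ B → u ∉ S
  ∈B⇒∉S = proj₁ ∘ to (∈-Bd⇔ (adj G))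

  v̂∈E⁺ : v̂ ∈ E⁺
  v̂∈E⁺ = from (↑ˡ∈++⇔ S⁺ ⊥) (x∈p∪q⁺ (inj₂ (x∈⁅x⁆ v)))

  v̂∉E : v̂ ∉ E
  v̂∉E = ∈B⇒∉S v∈B ∘ to (↑ˡ∈++⇔ S ⊥)

  E⊆E⁺ : E ⊆ E⁺
  E⊆E⁺ = embed-mono G (p⊆p∪q ⁅ v ⁆)

  ∈E⁺∖E⇒≡v̂ : ∀ {y} → y ∈ E⁺ → y ∉ E → y ≡ v̂
  ∈E⁺∖E⇒≡v̂ {y} y∈E⁺ y∉E with ↑-view n y
  ... | at-↑ʳ e = contradiction y∈E⁺ (↑ʳ∉embed G)
  ... | at-↑ˡ u with x∈p∪q⁻ S ⁅ v ⁆ (to (↑ˡ∈++⇔ S⁺ ⊥) y∈E⁺)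
  ...   | inj₁ u∈S = contradiction (from (↑ˡ∈++⇔ S ⊥) u∈S) y∉E
  ...   | inj₂ u∈v = cong (_↑ˡ k) (x∈⁅y⁆⇒x≡y v u∈v)

  ∣E⁺∣≡1+∣E∣ : ∣ E⁺ ∣ ≡ suc ∣ E ∣
  ∣E⁺∣≡1+∣E∣ = begin
    ∣ E⁺ ∣              ≡⟨ ∣embed∣ G S⁺ ⟩
    ∣ S ∪ ⁅ v ⁆ ∣       ≡⟨ disjoint⇒∣p∪q∣≡∣p∣+∣q∣ S ⁅ v ⁆ S∩v≡∅ ⟩
    ∣ S ∣ + ∣ ⁅ v ⁆ ∣   ≡⟨ cong (∣ S ∣ +_) (∣⁅x⁆∣≡1 v) ⟩
    ∣ S ∣ + 1           ≡⟨ +-comm ∣ S ∣ 1 ⟩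
    suc ∣ S ∣           ≡⟨ cong suc (∣embed∣ G S) ⟨
    suc ∣ E ∣           ∎
    where
    open ≡-Reasoning
    S∩v≡∅ : Empty (S ∩ ⁅ v ⁆)
    S∩v≡∅ (u , u∈S∩v) with u∈S , u∈v ← x∈p∩q⁻ S ⁅ v ⁆ u∈S∩v =
      ∈B⇒∉S v∈B (subst (_∈ S) (x∈⁅y⁆⇒x≡y v u∈v) u∈S)

  joinsB : Fin n × Fin n → Bool
  joinsB (i , j) = incident v (i , j) ∧ lookup B i ∧ lookup B j

  joining-edges : Subset k
  joining-edges = tabulate (joinsB ∘ List.lookup (edges G))

  -- The subdivision vertices v_e of R(G) for the edges e from v to another vertex of B.
  D : Subset (order-R G)
  D = ⊥ ++ joining-edges

  ∈D⇒joinsB : ∀ {e} → n ↑ʳ e ∈ D → T (joinsB (List.lookup (edges G) e))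
  ∈D⇒joinsB {e} =
    subst T (lookup∘tabulate _ e) ∘ to ∈⇔T-lookup ∘ to (↑ʳ∈++⇔ ⊥ joining-edges)

  joinsB-endpoint∈B : ∀ p {a} → T (joinsB p) → T (incident a p) → a ∈ B
  joinsB-endpoint∈B (i , j) {a} joins a∈p
    with _ , Bi∧Bj ← to (T-∧ {incident v (i , j)}) joins
    with Bi , Bj ← to (T-∧ {lookup B i}) Bi∧Bj
    with to (incident⇔ {a = a} {i} {j}) a∈p
  ... | inj₁ refl = from ∈⇔T-lookup Bi
  ... | inj₂ refl = from ∈⇔T-lookup Bj

  Bd∩D≡∅ : Empty (Bd (adjR G) E ∩ D)
  Bd∩D≡∅ (y , y∈Bd∩D) with y∈Bd , y∈D ← x∈p∩q⁻ (Bd (adjR G) E) D y∈Bd∩D | ↑-view n y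
  ... | at-↑ˡ u = ∉⊥ (to (↑ˡ∈++⇔ ⊥ joining-edges) y∈D)
  ... | at-↑ʳ e with _ , x , x∈E , x~y ← to (∈-Bd⇔ (adjR G)) y∈Bd | ↑-view n x
  ...   | at-↑ʳ _ = ↑ʳ∉embed G x∈E
  ...   | at-↑ˡ a = ∈B⇒∉S a∈B (to (↑ˡ∈++⇔ S ⊥) x∈E)
    where a∈B = joinsB-endpoint∈B _ (∈D⇒joinsB y∈D) (subst T (adjR-↑ˡ-↑ʳ G a e) x~y)

  Bd∪D⊆Bd⁺∪v̂ : Bd (adjR G) E ∪ D ⊆ Bd (adjR G) E⁺ ∪ ⁅ v̂ ⁆
  Bd∪D⊆Bd⁺∪v̂ {y} y∈Bd∪D with x∈p∪q⁻ (Bd (adjR G) E) D y∈Bd∪D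
  ... | inj₁ y∈Bd with y ∈? E⁺
  ...   | no  y∉E⁺ = x∈p∪q⁺ (inj₁ (Bd-mono (adjR G) E⊆E⁺ y∉E⁺ y∈Bd))
  ...   | yes y∈E⁺ = x∈p∪q⁺ (inj₂ (subst (_∈ ⁅ v̂ ⁆) (sym y≡v̂) (x∈⁅x⁆ v̂)))
    where y≡v̂ = ∈E⁺∖E⇒≡v̂ y∈E⁺ (proj₁ (to (∈-Bd⇔ (adjR G)) y∈Bd))
  Bd∪D⊆Bd⁺∪v̂ {y} _ | inj₂ y∈D with ↑-view n y
  ... | at-↑ˡ u = contradiction (to (↑ˡ∈++⇔ ⊥ joining-edges) y∈D) ∉⊥
  ... | at-↑ʳ e = x∈p∪q⁺ (inj₁ (from (∈-Bd⇔ (adjR G)) (↑ʳ∉embed G , v̂ , v̂∈E⁺ , v̂~y)))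
    where v̂~y = subst T (sym (adjR-↑ˡ-↑ʳ G v e)) (proj₁ (to T-∧ (∈D⇒joinsB y∈D)))

  joinsB-sym : ∀ i j → 𝟙 (joinsB (i , j)) ≡ 𝟙 (joinsB (j , i))
  joinsB-sym i j =
    cong 𝟙 (cong₂ _∧_ (∨-comm ⌊ v ≟ i ⌋ ⌊ v ≟ j ⌋) (∧-comm (lookup B i) (lookup B j)))

  joinsB-at-v : ∀ u → joinsB (u , v) ≡ lookup B u
  joinsB-at-v u =
    trans (cong₂ (λ x y → x ∧ lookup B u ∧ y) v-incident B[v]) (∧-identityʳ (lookup B u))
    where
    v-incident : incident v (u , v) ≡ true
    v-incident = trans (cong (⌊ v ≟ u ⌋ ∨_) (to T-≡ (fromWitness {a? = v ≟ v} refl))) (∨-zeroʳ _)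
    B[v] : lookup B v ≡ true
    B[v] = to T-≡ (to ∈⇔T-lookup v∈B)

  degB : ℕ
  degB = ∣ tabulate (λ u → lookup B u ∧ adj G u v) ∣

  degB≤∣D∣ : degB ≤ ∣ D ∣
  degB≤∣D∣ = begin
    degB                                       ≡⟨ ∣tabulate∣≡sum𝟙 (λ u → lookup B u ∧ adj G u v) ⟩
    sum (λ u → 𝟙 (lookup B u ∧ adj G u v))     ≤⟨ sum-mono-≤ neighbour≤joinsB ⟩
    sum (λ u → if adj G u v then 𝟙 (joinsB (u , v)) else 0)
      ≤⟨ star≤sum-edges G v (𝟙 ∘ joinsB) joinsB-sym ⟩
    sum (𝟙 ∘ joinsB ∘ List.lookup (edges G))   ≡⟨ ∣tabulate∣≡sum𝟙 (joinsB ∘ List.lookup (edges G)) ⟨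
    ∣ joining-edges ∣                          ≡⟨ cong (_+ ∣ joining-edges ∣) (∣⊥∣≡0 n) ⟨
    ∣ ⊥ {n} ∣ + ∣ joining-edges ∣              ≡⟨ ∣p++q∣≡∣p∣+∣q∣ (⊥ {n}) joining-edges ⟨
    ∣ D ∣                                      ∎
    where
    open ≤-Reasoning
    neighbour≤joinsB : ∀ u → 𝟙 (lookup B u ∧ adj G u v) ≤
                             (if adj G u v then 𝟙 (joinsB (u , v)) else 0)
    neighbour≤joinsB u with adj G u v
    ... | true  = ≤-reflexive (cong 𝟙 (trans (∧-identityʳ _) (sym (joinsB-at-v u))))
    ... | false = ≤-reflexive (cong 𝟙 (∧-zeroʳ _))

  boundary-gain : ∣ Bd (adjR G) E ∣ + degB ≤ ∣ Bd (adjR G) E⁺ ∣ + 1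
  boundary-gain = begin
    ∣ Bd (adjR G) E ∣ + degB          ≤⟨ +-monoʳ-≤ _ degB≤∣D∣ ⟩
    ∣ Bd (adjR G) E ∣ + ∣ D ∣         ≡⟨ disjoint⇒∣p∪q∣≡∣p∣+∣q∣ (Bd (adjR G) E) D Bd∩D≡∅ ⟨
    ∣ Bd (adjR G) E ∪ D ∣             ≤⟨ p⊆q⇒∣p∣≤∣q∣ Bd∪D⊆Bd⁺∪v̂ ⟩
    ∣ Bd (adjR G) E⁺ ∪ ⁅ v̂ ⁆ ∣        ≤⟨ ∣p∪q∣≤∣p∣+∣q∣ (Bd (adjR G) E⁺) ⁅ v̂ ⁆ ⟩
    ∣ Bd (adjR G) E⁺ ∣ + ∣ ⁅ v̂ ⁆ ∣    ≡⟨ cong (∣ Bd (adjR G) E⁺ ∣ +_) (∣⁅x⁆∣≡1 v̂) ⟩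
    ∣ Bd (adjR G) E⁺ ∣ + 1            ∎
    where open ≤-Reasoning

  -- ∂ E + degB ≤ ∂ E⁺ + 2, with the subtractions cleared.
  ∂-gain : ∣ Bd (adjR G) E ∣ + ∣ E⁺ ∣ + degB ≤ ∣ Bd (adjR G) E⁺ ∣ + ∣ E ∣ + 2
  ∂-gain = begin
    P + ∣ E⁺ ∣ + degB          ≡⟨ cong (λ s → P + s + degB) ∣E⁺∣≡1+∣E∣ ⟩
    P + suc ∣ E ∣ + degB       ≡⟨ swap-last P ∣ E ∣ degB ⟩
    P + degB + suc ∣ E ∣       ≤⟨ +-monoˡ-≤ (suc ∣ E ∣) boundary-gain ⟩
    P⁺ + 1 + suc ∣ E ∣         ≡⟨ collect P⁺ ∣ E ∣ ⟩
    P⁺ + ∣ E ∣ + 2             ∎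
    where
    open ≤-Reasoning
    P P⁺ : ℕ
    P  = ∣ Bd (adjR G) E ∣
    P⁺ = ∣ Bd (adjR G) E⁺ ∣
    swap-last : ∀ a s d → a + suc s + d ≡ a + d + suc s
    swap-last = ℕ-solve-∀
    collect : ∀ b s → b + 1 + suc s ≡ b + s + 2
    collect = ℕ-solve-∀

module _ where
  open ℤ using (+_; -_; _-_; +≤+)

  +m-+n≤+o-+p⇔m+p≤o+n : ∀ m n o p → (+ m - + n ≤ℤ + o - + p) ⇔ (m + p ≤ o + n)
  +m-+n≤+o-+p⇔m+p≤o+n m n o p = mk⇔
    (λ le → ℤₚ.drop‿+≤+ (subst₂ _≤ℤ_ left right (ℤₚ.+-monoˡ-≤ k le)))
    (λ le → subst₂ _≤ℤ_ (undo _ k) (undo _ k)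
              (ℤₚ.+-monoˡ-≤ (- k) (subst₂ _≤ℤ_ (sym left) (sym right) (+≤+ le))))
    where
    k : ℤ.ℤ
    k = + n ℤ.+ + p
    cancelˡ : ∀ x y z → (x - y) ℤ.+ (y ℤ.+ z) ≡ x ℤ.+ z
    cancelˡ = solve-∀
    cancelʳ : ∀ x y z → (x - z) ℤ.+ (y ℤ.+ z) ≡ x ℤ.+ y
    cancelʳ = solve-∀
    undo : ∀ i j → i ℤ.+ j ℤ.+ - j ≡ i
    undo = solve-∀
    left : (+ m - + n) ℤ.+ k ≡ + (m + p)
    left = trans (cancelˡ (+ m) (+ n) (+ p)) (sym (ℤₚ.pos-+ m p))
    right : (+ o - + p) ℤ.+ k ≡ + (o + n)
    right = trans (cancelʳ (+ o) (+ n) (+ p)) (sym (ℤₚ.pos-+ o n))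

∂≤∂⇔ : ∀ {m} (a : Fin m → Fin m → Bool) X Y →
       (∂ a X ≤ℤ ∂ a Y) ⇔ (∣ Bd a X ∣ + ∣ Y ∣ ≤ ∣ Bd a Y ∣ + ∣ X ∣)
∂≤∂⇔ a X Y = +m-+n≤+o-+p⇔m+p≤o+n (∣ Bd a X ∣) (∣ X ∣) (∣ Bd a Y ∣) (∣ Y ∣)

proposition3p1 : (n : ℕ) → 3 ≤ n → (G : Graph n) → Connected G → (S : Subset n)
    → (IsDifferential (adjR G) (embed G S)
         → MaxDegInducedAtMost G (Bd (adj G) S) 2)
    × (IsMaximalDifferential (adjR G) (embed G S)
         → MaxDegInducedAtMost G (Bd (adj G) S) 1)
proposition3p1 n _ G _ S = degree≤2 , degree≤1
  where
  degree≤2 : IsDifferential (adjR G) (embed G S) → MaxDegInducedAtMost G (Bd (adj G) S) 2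
  degree≤2 differential v v∈B = +-cancelˡ-≤ _ degB 2 (begin
    ∣ Bd (adjR G) E ∣ + ∣ E⁺ ∣ + degB  ≤⟨ ∂-gain ⟩
    ∣ Bd (adjR G) E⁺ ∣ + ∣ E ∣ + 2     ≤⟨ +-monoˡ-≤ 2 (to (∂≤∂⇔ (adjR G) E⁺ E) (differential E⁺)) ⟩
    ∣ Bd (adjR G) E ∣ + ∣ E⁺ ∣ + 2     ∎)
    where
    open Extension G S v∈B
    open ≤-Reasoning

  degree≤1 : IsMaximalDifferential (adjR G) (embed G S) → MaxDegInducedAtMost G (Bd (adj G) S) 1
  degree≤1 (differential , maximal) v v∈B = ≮⇒≥ λ 2≤degB →
    v̂∉E (subst (v̂ ∈_) (maximal E⁺ (E⁺-differential 2≤degB) E⊆E⁺) v̂∈E⁺)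
    where
    open Extension G S v∈B
    E⁺-differential : 2 ≤ degB → IsDifferential (adjR G) E⁺
    E⁺-differential 2≤degB T = ℤₚ.≤-trans (differential T) (from (∂≤∂⇔ (adjR G) E E⁺)
      (+-cancelʳ-≤ 2 _ _ (≤-trans (+-monoʳ-≤ _ 2≤degB) ∂-gain)))
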